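{- Let $D$ be a digraph rooted at $r$, let $x\in V(D)\setminus\{r\}$, and let $\mathcal S$ be a non-empty collection of subsets of $V(D)\setminus\{r\}$ such that each $S\in\mathcal S$ separates $x$ from $r$. Let $\bigvee\mathcal S$ be the set of those elements $s\in\bigcup\mathcal S$ that are separated from $r$ by every $S\in\mathcal S$. Then $\bigvee\mathcal S$ separates $x$ from $r$.
   Context: A vertex set $S$ separates a vertex $y$ from $r$ if every directed path from $r$ to $y$ meets $S$ (in particular, every vertex of $S$ is separated from $r$ by $S$). -}

module Defs where

open import Level using (Level; 0ℓ; _⊔_) renaming (suc to lsuc)
open import Data.List using (List; []; _∷_)
open import Data.List.Relation.Unary.Any using (Any)
open import Data.List.Relation.Unary.Unique.Propositional using (Unique)
open import Data.Product using (Σ; ∃; _×_)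
open import Relation.Binary.PropositionalEquality using (_≢_)

record Digraph : Set₁ where
  field
    V : Set
    E : V → V → Set

module _ (D : Digraph) where
  open Digraph D

  VSet : Set₁
  VSet = V → Set

  data Walk : V → V → Set where
    stop : (v : V) → Walk v v
    step : {u v w : V} → E u v → Walk v w → Walk u w

  verts : {u v : V} → Walk u v → List V
  verts (stop v) = v ∷ []
  verts (step {u} _ p) = u ∷ verts p

  IsPath : {u v : V} → Walk u v → Set
  IsPath p = Unique (verts p)

  Meets : {ℓ : Level} → (V → Set ℓ) → {u v : V} → Walk u v → Set ℓ
  Meets S p = Any S (verts p)

  Separates : {ℓ : Level} → (r : V) → (V → Set ℓ) → V → Set ℓ
  Separates r S y = (p : Walk r y) → IsPath p → Meets S p

  Join : (r : V) → (VSet → Set) → V → Set₁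
  Join r 𝒮 s = (∃ λ S → 𝒮 S × S s) × ((S : VSet) → 𝒮 S → Separates r S s)

module Submission where

-- Let P be a path from r to x and U = ⋃𝒮.  Some S₀ ∈ 𝒮
-- separates x from r, so P meets U; let s be the LAST vertex of P in U
-- and q the segment of P from s to x, whose vertices after s avoid U.
-- Then s ∈ ⋁𝒮: for S ∈ 𝒮 and any r–s walk Q, the walk Q followed by q
-- reaches x, hence meets S (a separator of x meets every r–x walk, not
-- only every path, because walks can be shortcut to paths); it cannot
-- meet S strictly after s, so it meets S on Q.  Since s lies on P, P
-- meets ⋁𝒮.
--
-- Excluded middle is used only to decide
-- membership on vertex lists (shortcutting) and to locate the last hit.

open import Defs
open import Level using (Level; 0ℓ; suc; lift; lower)
open import Axiom.ExcludedMiddle using (ExcludedMiddle)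
open import Data.Product using (Σ; ∃; _×_; _,_)
open import Data.Sum using (_⊎_; inj₁; inj₂)
open import Data.Empty using (⊥-elim)
open import Data.List using (List; []; _∷_)
open import Data.List.Relation.Unary.Any as Any using (Any; here; there)
open import Data.List.Relation.Unary.All as All using (All; []; _∷_)
open import Data.List.Relation.Unary.All.Properties using (¬Any⇒All¬; All¬⇒¬Any)
open import Data.List.Relation.Unary.AllPairs using ([]; _∷_)
open import Data.List.Membership.Propositional using (_∈_; lose)
open import Data.List.Relation.Binary.Subset.Propositional using (_⊆_)
open import Data.List.Relation.Binary.Subset.Propositional.Properties using (Any-resp-⊆)
open import Relation.Nullary using (¬_; yes; no)
open import Relation.Nullary.Decidable using (map′)
open import Relation.Binary.PropositionalEquality using (_≢_; refl)

lower-em : {ℓ : Level} → ExcludedMiddle (suc ℓ) → ExcludedMiddle ℓ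
lower-em em = map′ lower lift em

module _ (D : Digraph) where
  open Digraph D

  _++ʷ_ : {a b c : V} → Walk D a b → Walk D b c → Walk D a c
  stop _ ++ʷ q = q
  step e p ++ʷ q = step e (p ++ʷ q)

  later : {u v : V} → Walk D u v → List V
  later (stop _) = []
  later (step _ p) = verts D p

  end∈verts : {u v : V} (p : Walk D u v) → v ∈ verts D p
  end∈verts (stop v) = here refl
  end∈verts (step e p) = there (end∈verts p)

  meets-++ʷ : {ℓ : Level} {P : V → Set ℓ} {a b c : V}
              (p : Walk D a b) (q : Walk D b c) →
              Meets D P (p ++ʷ q) → Meets D P p ⊎ Meets D P q
  meets-++ʷ (stop _) q m = inj₂ m
  meets-++ʷ (step e p) q (here Pa) = inj₁ (here Pa)
  meets-++ʷ (step e p) q (there m) with meets-++ʷ p q m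
  ... | inj₁ mp = inj₁ (there mp)
  ... | inj₂ mq = inj₂ mq

  suffix-path : {a u v : V} (p : Walk D a v) → u ∈ verts D p → IsPath D p →
                Σ (Walk D u v) λ q → IsPath D q × verts D q ⊆ verts D p
  suffix-path (stop v) (here refl) path-p = stop v , path-p , λ t∈ → t∈
  suffix-path (step e p) (here refl) path-p = step e p , path-p , λ t∈ → t∈
  suffix-path (step e p) (there u∈p) (_ ∷ path-p) with suffix-path p u∈p path-p
  ... | q , path-q , q⊆p = q , path-q , λ t∈q → there (q⊆p t∈q)

  -- Every walk contains a path with the same ends: cut out the cycle
  -- through the first vertex whenever it reappears later.
  shortcut : ExcludedMiddle 0ℓ → {u v : V} (w : Walk D u v) →
             Σ (Walk D u v) λ p → IsPath D p × verts D p ⊆ verts D w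
  shortcut em (stop v) = stop v , [] ∷ [] , λ t∈ → t∈
  shortcut em {u} (step e w) with shortcut em w
  ... | p , path-p , p⊆w with em {u ∈ verts D p}
  ...   | yes u∈p =
    let q , path-q , q⊆p = suffix-path p u∈p path-p
    in q , path-q , λ t∈q → there (p⊆w (q⊆p t∈q))
  ...   | no u∉p =
    step e p , ¬Any⇒All¬ (verts D p) u∉p ∷ path-p ,
    λ { (here t≡u) → here t≡u ; (there t∈p) → there (p⊆w t∈p) }

  separates-walks : ExcludedMiddle 0ℓ → {ℓ : Level} {r y : V} {S : V → Set ℓ} →
                    Separates D r S y → (w : Walk D r y) → Meets D S w
  separates-walks em sep w =
    let p , path-p , p⊆w = shortcut em w
    in Any-resp-⊆ p⊆w (sep p path-p)

  last-hit : {ℓ : Level} → ExcludedMiddle ℓ → (U : V → Set ℓ) {u x : V}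
             (p : Walk D u x) → Meets D U p →
             Σ V λ s → s ∈ verts D p × U s ×
               Σ (Walk D s x) λ q → All (λ t → ¬ U t) (later q)
  last-hit em U (stop v) (here Uv) = v , here refl , Uv , stop v , []
  last-hit em U (step e p) m with em {Meets D U p}
  ... | yes mp =
    let s , s∈p , Us , q = last-hit em U p mp
    in s , there s∈p , Us , q
  last-hit em U (step e p) (here Uu) | no ¬mp =
    _ , here refl , Uu , step e p , ¬Any⇒All¬ (verts D p) ¬mp
  last-hit em U (step e p) (there mp) | no ¬mp = ⊥-elim (¬mp mp)

  separation-backwards : ExcludedMiddle 0ℓ → {ℓ : Level} {r s x : V}
                         (S : V → Set ℓ) → Separates D r S x →
                         (q : Walk D s x) → All (λ t → ¬ S t) (later q) →
                         Separates D r S s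
  separation-backwards em {s = s} S sep-x q q-avoids Q _
    with meets-++ʷ Q q (separates-walks em sep-x (Q ++ʷ q))
  ... | inj₁ meets-Q = meets-Q
  ... | inj₂ meets-q = meets-start q q-avoids meets-q
    where
    -- q can only meet S at its first vertex s, which is the end of Q.
    meets-start : {y : V} (q : Walk D s y) → All (λ t → ¬ S t) (later q) →
                  Meets D S q → Meets D S Q
    meets-start (stop _) _ (here Ss) = lose (end∈verts Q) Ss
    meets-start (step _ _) _ (here Ss) = lose (end∈verts Q) Ss
    meets-start (step _ _) avoids (there m) = ⊥-elim (All¬⇒¬Any avoids m)

  ⋃ : (VSet D → Set) → V → Set₁
  ⋃ 𝒮 v = ∃ λ S → 𝒮 S × S v

lemma5p1 : ExcludedMiddle (suc 0ℓ) →
    (D : Digraph) → (r x : Digraph.V D) → x ≢ r →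
    (𝒮 : VSet D → Set) → (∃ λ S → 𝒮 S) →
    ((S : VSet D) → 𝒮 S → ((v : Digraph.V D) → S v → v ≢ r) × Separates D r S x) →
    Separates D r (Join D r 𝒮) x
lemma5p1 em D r x _ 𝒮 (S₀ , S₀∈𝒮) hyp P path-P =
  let s , s∈P , s∈⋃ , q , q-avoids-⋃ = last-hit D em (⋃ D 𝒮) P P-meets-⋃
  in lose s∈P (s∈⋃ , λ S S∈𝒮 →
       separation-backwards D (lower-em em) S (separates-x S S∈𝒮) q
         (All.map (avoids-member S∈𝒮) q-avoids-⋃))
  where
  open Digraph D using (V)

  separates-x : (S : VSet D) → 𝒮 S → Separates D r S x
  separates-x S S∈𝒮 = let _ , sep = hyp S S∈𝒮 in sep

  P-meets-⋃ : Meets D (⋃ D 𝒮) P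
  P-meets-⋃ = Any.map (λ S₀v → S₀ , S₀∈𝒮 , S₀v) (separates-x S₀ S₀∈𝒮 P path-P)

  avoids-member : {S : VSet D} → 𝒮 S → {t : V} → ¬ ⋃ D 𝒮 t → ¬ S t
  avoids-member {S} S∈𝒮 t∉⋃ St = t∉⋃ (S , S∈𝒮 , St)
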